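{- Let $m \geq n \geq 1$ and $\ell \geq 1$ be integers. Then there exist a minimum zero-forcing set $B$ of the complete bipartite graph $K_{m,n}$ and a minimum $\ell$-leaky forcing set $B_\ell$ of $K_{m,n}$ with $B \subseteq B_\ell$.
   Context: Let $G=(V,E)$ be a finite simple graph. Color change rule: a colored vertex $v$ colors an uncolored vertex $u$ if $u$ is the only uncolored neighbor of $v$. A zero-forcing set is a set $B\subseteq V$ such that, starting with $B$ colored, repeated application of the rule colors all of $V$; minimum means of minimum size. In $\ell$-leaky forcing, after $B$ is colored an adversary places leaks on at most $\ell$ vertices; a leaky vertex never forces. $B$ is an $\ell$-leaky forcing set if for every placement of at most $\ell$ leaks the process still colors all of $V$. $K_{m,n}$ has parts $X,Y$ with $|X|=m$, $|Y|=n$, and all edges between $X$ and $Y$. -}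

module Defs where

open import Data.Nat using (ℕ; _+_; _<_; _≤_)
open import Data.Nat.Properties using (<⇒≱; <-irrefl)
open import Data.Fin using (Fin; toℕ)
open import Data.Fin.Subset using (Subset; _∈_; _∉_; ∣_∣; ⊥)
open import Data.Product using (_×_; _,_)
open import Data.Sum using (_⊎_; inj₁; inj₂)
open import Relation.Nullary using (¬_)
open import Relation.Binary.PropositionalEquality using (_≡_)

record SimpleGraph (N : ℕ) : Set₁ where
  field
    Adj   : Fin N → Fin N → Set
    sym   : ∀ {u v} → Adj u v → Adj v u
    irref : ∀ {u} → ¬ Adj u u

open SimpleGraph public

-- Complete bipartite graph K_{m,n}: vertices Fin (m + n);
-- X = {i | toℕ i < m} (size m), Y = {i | m ≤ toℕ i} (size n).
KAdj : (m n : ℕ) → Fin (m + n) → Fin (m + n) → Set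
KAdj m n u v = (toℕ u < m × m ≤ toℕ v) ⊎ (m ≤ toℕ u × toℕ v < m)

K : (m n : ℕ) → SimpleGraph (m + n)
K m n = record
  { Adj = KAdj m n
  ; sym = λ { (inj₁ (a , b)) → inj₂ (b , a) ; (inj₂ (a , b)) → inj₁ (b , a) }
  ; irref = λ { (inj₁ (a , b)) → <⇒≱ a b ; (inj₂ (a , b)) → <⇒≱ b a }
  }

-- This is the
-- least set containing B and closed under forcing, i.e. the final colored set.
data Colored {N : ℕ} (G : SimpleGraph N) (B L : Subset N) : Fin N → Set where
  initial : ∀ {u} → u ∈ B → Colored G B L u
  force   : ∀ {v u} → Colored G B L v → v ∉ L → Adj G v u →
            (∀ w → Adj G v w → ¬ (w ≡ u) → Colored G B L w) →
            Colored G B L u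

IsZeroForcingSet : ∀ {N} → SimpleGraph N → Subset N → Set
IsZeroForcingSet G B = ∀ u → Colored G B ⊥ u

IsMinZeroForcingSet : ∀ {N} → SimpleGraph N → Subset N → Set
IsMinZeroForcingSet G B =
  IsZeroForcingSet G B × (∀ B′ → IsZeroForcingSet G B′ → ∣ B ∣ ≤ ∣ B′ ∣)

IsLeakyForcingSet : ∀ {N} → ℕ → SimpleGraph N → Subset N → Set
IsLeakyForcingSet ℓ G B = ∀ (L : Subset _) → ∣ L ∣ ≤ ℓ → ∀ u → Colored G B L u

IsMinLeakyForcingSet : ∀ {N} → ℕ → SimpleGraph N → Subset N → Set
IsMinLeakyForcingSet ℓ G B =
  IsLeakyForcingSet ℓ G B × (∀ B′ → IsLeakyForcingSet ℓ G B′ → ∣ B ∣ ≤ ∣ B′ ∣)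

-- In K_{m,n} two vertices of the same part are twins: whoever is adjacent to one is adjacent
-- to both, so a vertex can never force either of them while both are uncolored.  Hence a zero
-- forcing set misses at most one vertex per part, and V ∖ {x₀, y₀} (x₀ ∈ X, y₀ ∈ Y) is optimal
-- once m ≥ 2.  With ℓ ≥ n leaks the adversary leaks all of Y; an X-vertex outside B then has
-- only leaky neighbours and stays uncolored, so X ⊆ B, and symmetrically Y ⊆ B when ℓ ≥ m.
-- Conversely, fewer than n leaks leave a non-leaky vertex in each part and one outside
-- {x₀, y₀}, which lets V ∖ {x₀, y₀} force x₀ and y₀ one after the other; fewer than m leaks
-- leave a non-leaky X-vertex, which forces y₀ from V ∖ {y₀}.  The minimum ℓ-leaky
-- set is thus one of V ∖ {x₀, y₀}, V ∖ {y₀}, V, and each contains V ∖ {x₀, y₀}.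

module Submission where

open import Defs
open import Data.Nat using (ℕ; _≤_; _+_)
open import Data.Fin.Subset using (Subset; _⊆_)
open import Data.Product using (Σ; _×_)

open import Data.Nat using (zero; suc; _<_; z≤n; s≤s; _<?_)
open import Data.Nat.Properties
  using (≤-trans; ≤-reflexive; +-identityʳ; module ≤-Reasoning; <⇒≱; ≮⇒≥; m≤m+n; +-mono-≤; +-cancelˡ-≤; +-suc; ≤-<-trans)
open import Data.Fin using (Fin; zero; suc; toℕ; _↑ˡ_; _↑ʳ_; fromℕ<)
open import Data.Fin.Properties using (toℕ-↑ˡ; toℕ-↑ʳ; toℕ<n; ↑ˡ-injective; ↑ʳ-injective; 0≢1+n; suc-injective; ¬∀⟶∃¬; _≟_)
open import Data.Fin.Subset using (_∈_; _∉_; ∣_∣; ⊤; ⊥; inside; outside; Nonempty)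
open import Data.Fin.Subset.Properties
  using (_∈?_; ∈⊤; ∉⊥; ⊆⊤; ∣⊤∣≡n; ∣⊥∣≡0; ∣p∣≤∣x∷p∣; p⊆q⇒∣p∣≤∣q∣; drop-there)
open import Data.Vec using ([]; _∷_; _++_; splitAt; here; there)
open import Data.Vec.Properties using (lookup-++ˡ; lookup-++ʳ; []=⇒lookup; lookup⇒[]=)
open import Data.Product using (∃; _,_; proj₁; proj₂)
open import Data.Sum using (_⊎_; inj₁; inj₂)
open import Data.Empty using (⊥-elim)
open import Function using (_∘_; id)
open import Relation.Nullary using (¬_; yes; no)
open import Relation.Nullary.Decidable using (decidable-stable; _→-dec_)
open import Relation.Binary.PropositionalEquality as ≡ using (_≡_; _≢_; refl; trans; cong; cong₂; subst; module ≡-Reasoning)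

-- Subsets and their sizes

module _ {k l : ℕ} {p : Subset k} {q : Subset l} where

  ∈-++⁺ˡ : ∀ {i} → i ∈ p → i ↑ˡ l ∈ p ++ q
  ∈-++⁺ˡ {i} i∈p = lookup⇒[]= (i ↑ˡ l) (p ++ q) (trans (lookup-++ˡ p q i) ([]=⇒lookup i∈p))

  ∈-++⁻ˡ : ∀ {i} → i ↑ˡ l ∈ p ++ q → i ∈ p
  ∈-++⁻ˡ {i} i∈p++q = lookup⇒[]= i p (trans (≡.sym (lookup-++ˡ p q i)) ([]=⇒lookup i∈p++q))

  ∈-++⁺ʳ : ∀ {j} → j ∈ q → k ↑ʳ j ∈ p ++ q
  ∈-++⁺ʳ {j} j∈q = lookup⇒[]= (k ↑ʳ j) (p ++ q) (trans (lookup-++ʳ p q j) ([]=⇒lookup j∈q))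

  ∈-++⁻ʳ : ∀ {j} → k ↑ʳ j ∈ p ++ q → j ∈ q
  ∈-++⁻ʳ {j} j∈p++q = lookup⇒[]= j q (trans (≡.sym (lookup-++ʳ p q j)) ([]=⇒lookup j∈p++q))

∣p++q∣≡∣p∣+∣q∣ : ∀ {k l} (p : Subset k) (q : Subset l) → ∣ p ++ q ∣ ≡ ∣ p ∣ + ∣ q ∣
∣p++q∣≡∣p∣+∣q∣ []            q = refl
∣p++q∣≡∣p∣+∣q∣ (inside  ∷ p) q = cong suc (∣p++q∣≡∣p∣+∣q∣ p q)
∣p++q∣≡∣p∣+∣q∣ (outside ∷ p) q = ∣p++q∣≡∣p∣+∣q∣ p q

x∈p⇒0<∣p∣ : ∀ {k} {p : Subset k} {x} → x ∈ p → 0 < ∣ p ∣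
x∈p⇒0<∣p∣ here        = s≤s z≤n
x∈p⇒0<∣p∣ {p = b ∷ p} (there x∈p) = ≤-trans (x∈p⇒0<∣p∣ x∈p) (∣p∣≤∣x∷p∣ b p)

⊤⊆p⇒n≤∣p∣ : ∀ {k} {p : Subset k} → ⊤ ⊆ p → k ≤ ∣ p ∣
⊤⊆p⇒n≤∣p∣ {k} {p} ⊤⊆p = subst (_≤ ∣ p ∣) (∣⊤∣≡n k) (p⊆q⇒∣p∣≤∣q∣ ⊤⊆p)

∉-unique⇒n≤1+∣p∣ : ∀ {k} (p : Subset k) → (∀ i j → i ∉ p → j ∉ p → i ≡ j) → k ≤ suc ∣ p ∣
∉-unique⇒n≤1+∣p∣ []            _      = z≤n
∉-unique⇒n≤1+∣p∣ (inside  ∷ p) unique = s≤s (∉-unique⇒n≤1+∣p∣ p λ i j i∉p j∉p →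
  suc-injective (unique (suc i) (suc j) (i∉p ∘ drop-there) (j∉p ∘ drop-there)))
∉-unique⇒n≤1+∣p∣ (outside ∷ p) unique = s≤s (⊤⊆p⇒n≤∣p∣ λ {i} _ →
  decidable-stable (i ∈? p) λ i∉p → 0≢1+n (unique zero (suc i) (λ ()) (i∉p ∘ drop-there)))

∣p∣<∣q∣⇒∃∈q∉p : ∀ {k} (p q : Subset k) → ∣ p ∣ < ∣ q ∣ → ∃ λ i → i ∈ q × i ∉ p
∣p∣<∣q∣⇒∃∈q∉p {k} p q ∣p∣<∣q∣ = i , i∈q , i∉p
  where
  q⊈p : ¬ (∀ i → i ∈ q → i ∈ p)
  q⊈p q⊆p = <⇒≱ ∣p∣<∣q∣ (p⊆q⇒∣p∣≤∣q∣ (q⊆p _))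
  counterexample : ∃ λ i → ¬ (i ∈ q → i ∈ p)
  counterexample = ¬∀⟶∃¬ k _ (λ i → (i ∈? q) →-dec (i ∈? p)) q⊈p
  i : Fin k
  i = proj₁ counterexample
  i∈q : i ∈ q
  i∈q = decidable-stable (i ∈? q) λ i∉q → proj₂ counterexample (⊥-elim ∘ i∉q)
  i∉p : i ∉ p
  i∉p i∈p = proj₂ counterexample λ _ → i∈p

-- Forcing in an arbitrary graph

Twins : ∀ {N} → SimpleGraph N → Fin N → Fin N → Set
Twins G a b = ∀ w → (Adj G w a → Adj G w b) × (Adj G w b → Adj G w a)

module _ {N : ℕ} {G : SimpleGraph N} {B L : Subset N} where

  Colored-ind : (P : Fin N → Set) → (∀ {u} → u ∈ B → P u) →
    (∀ {v u} → P v → v ∉ L → Adj G v u → (∀ w → Adj G v w → w ≢ u → P w) → P u) →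
    ∀ {u} → Colored G B L u → P u
  Colored-ind P base step (initial u∈B)         = base u∈B
  Colored-ind P base step (force cv v∉L vu cvw) =
    step (Colored-ind P base step cv) v∉L vu (λ w vw w≢u → Colored-ind P base step (cvw w vw w≢u))

  Colored⇒Nonempty : ∀ {u} → Colored G B L u → Nonempty B
  Colored⇒Nonempty = Colored-ind (λ _ → Nonempty B) (λ {u} u∈B → u , u∈B) (λ nonempty _ _ _ → nonempty)

  twins-uncolored : ∀ {a b} → Twins G a b → a ≢ b → a ∉ B → b ∉ B → ¬ Colored G B L a
  twins-uncolored {a} {b} twins a≢b a∉B b∉B = ¬Pa ∘ Colored-ind P inj₁ step
    where
    P : Fin N → Set
    P u = u ∈ B ⊎ (u ≢ a × u ≢ b)
    ¬Pa : ¬ P a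
    ¬Pa (inj₁ a∈B)       = a∉B a∈B
    ¬Pa (inj₂ (a≢a , _)) = a≢a refl
    ¬Pb : ¬ P b
    ¬Pb (inj₁ b∈B)       = b∉B b∈B
    ¬Pb (inj₂ (_ , b≢b)) = b≢b refl
    step : ∀ {v u} → P v → v ∉ L → Adj G v u → (∀ w → Adj G v w → w ≢ u → P w) → P u
    step {v} {u} _ _ vu Pw with u ≟ a | u ≟ b
    ... | yes refl | _        = ⊥-elim (¬Pb (Pw b (proj₁ (twins v) vu) (a≢b ∘ ≡.sym)))
    ... | no _     | yes refl = ⊥-elim (¬Pa (Pw a (proj₂ (twins v) vu) a≢b))
    ... | no u≢a   | no u≢b   = inj₂ (u≢a , u≢b)

  leaky-neighbours⇒uncolored : ∀ {a} → (∀ v → Adj G v a → v ∈ L) → a ∉ B → ¬ Colored G B L a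
  leaky-neighbours⇒uncolored {a} leaky a∉B = ¬Pa ∘ Colored-ind P inj₁ step
    where
    P : Fin N → Set
    P u = u ∈ B ⊎ u ≢ a
    ¬Pa : ¬ P a
    ¬Pa (inj₁ a∈B) = a∉B a∈B
    ¬Pa (inj₂ a≢a) = a≢a refl
    step : ∀ {v u} → P v → v ∉ L → Adj G v u → (∀ w → Adj G v w → w ≢ u → P w) → P u
    step {v} {u} _ v∉L vu _ with u ≟ a
    ... | yes refl = ⊥-elim (v∉L (leaky v vu))
    ... | no u≢a   = inj₂ u≢a

  force-last : ∀ {u v} → (∀ w → w ≢ u → Colored G B L w) → v ∉ L → Adj G v u →
    ∀ w → Colored G B L w
  force-last {u} {v} others v∉L vu w with w ≟ u
  ... | no w≢u   = others w w≢u
  ... | yes refl = force (others v λ { refl → irref G vu }) v∉L vu (λ w′ _ → others w′)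

  force-two-last : ∀ {a b v w} → (∀ u → u ≢ a → u ≢ b → u ∈ B) →
    v ∉ L → v ≢ a → Adj G v b → ¬ Adj G v a → w ∉ L → Adj G w a → ∀ u → Colored G B L u
  force-two-last {a} {b} {v} almost v∉L v≢a vb ¬va w∉L wa = force-last colored-but-a w∉L wa
    where
    colored-b : Colored G B L b
    colored-b = force (initial (almost v v≢a λ { refl → irref G vb })) v∉L vb
      (λ u vu u≢b → initial (almost u (λ { refl → ¬va vu }) u≢b))
    colored-but-a : ∀ u → u ≢ a → Colored G B L u
    colored-but-a u u≢a with u ≟ b
    ... | yes refl = colored-b
    ... | no u≢b   = initial (almost u u≢a u≢b)

zeroForcing⇒0<∣B∣ : ∀ {N} {G : SimpleGraph (suc N)} {B} → IsZeroForcingSet G B → 0 < ∣ B ∣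
zeroForcing⇒0<∣B∣ zf = x∈p⇒0<∣p∣ (proj₂ (Colored⇒Nonempty (zf zero)))

module _ {N ℓ : ℕ} {G : SimpleGraph N} where

  leaky⇒zeroForcing : ∀ {B} → IsLeakyForcingSet ℓ G B → IsZeroForcingSet G B
  leaky⇒zeroForcing lk = lk ⊥ (≤-trans (≤-reflexive (∣⊥∣≡0 N)) z≤n)

  minZeroForcing⇒minLeaky : ∀ {B} → IsMinZeroForcingSet G B → IsLeakyForcingSet ℓ G B →
    IsMinLeakyForcingSet ℓ G B
  minZeroForcing⇒minLeaky (_ , minimal) lk = lk , λ B′ lk′ → minimal B′ (leaky⇒zeroForcing lk′)

  ⊤-leakyForcing : IsLeakyForcingSet ℓ G ⊤
  ⊤-leakyForcing _ _ _ = initial ∈⊤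

-- Complete bipartite graphs

data Side (m n : ℕ) : Fin (m + n) → Set where
  left  : (i : Fin m) → Side m n (i ↑ˡ n)
  right : (j : Fin n) → Side m n (m ↑ʳ j)

side : ∀ m n u → Side m n u
side zero    n u       = right u
side (suc m) n zero    = left zero
side (suc m) n (suc u) with side m n u
... | left i  = left (suc i)
... | right j = right j

module CompleteBipartite (m n : ℕ) where

  toℕ-↑ˡ<m : ∀ (i : Fin m) → toℕ (i ↑ˡ n) < m
  toℕ-↑ˡ<m i = subst (_< m) (≡.sym (toℕ-↑ˡ i n)) (toℕ<n i)

  m≤toℕ-↑ʳ : ∀ (j : Fin n) → m ≤ toℕ (m ↑ʳ j)
  m≤toℕ-↑ʳ j = subst (m ≤_) (≡.sym (toℕ-↑ʳ m j)) (m≤m+n m (toℕ j))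

  adj-↑ˡ↑ʳ : ∀ i j → KAdj m n (i ↑ˡ n) (m ↑ʳ j)
  adj-↑ˡ↑ʳ i j = inj₁ (toℕ-↑ˡ<m i , m≤toℕ-↑ʳ j)

  adj-↑ʳ↑ˡ : ∀ j i → KAdj m n (m ↑ʳ j) (i ↑ˡ n)
  adj-↑ʳ↑ˡ j i = inj₂ (m≤toℕ-↑ʳ j , toℕ-↑ˡ<m i)

  ¬adj-↑ˡ↑ˡ : ∀ i i′ → ¬ KAdj m n (i ↑ˡ n) (i′ ↑ˡ n)
  ¬adj-↑ˡ↑ˡ i i′ (inj₁ (_ , m≤i′)) = <⇒≱ (toℕ-↑ˡ<m i′) m≤i′
  ¬adj-↑ˡ↑ˡ i i′ (inj₂ (m≤i , _))  = <⇒≱ (toℕ-↑ˡ<m i) m≤i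

  ¬adj-↑ʳ↑ʳ : ∀ j j′ → ¬ KAdj m n (m ↑ʳ j) (m ↑ʳ j′)
  ¬adj-↑ʳ↑ʳ j j′ (inj₁ (j<m , _))  = <⇒≱ j<m (m≤toℕ-↑ʳ j)
  ¬adj-↑ʳ↑ʳ j j′ (inj₂ (_ , j′<m)) = <⇒≱ j′<m (m≤toℕ-↑ʳ j′)

  ↑ˡ-twins : ∀ i i′ → Twins (K m n) (i ↑ˡ n) (i′ ↑ˡ n)
  ↑ˡ-twins i i′ w = retarget i i′ , retarget i′ i
    where
    retarget : ∀ i i′ → KAdj m n w (i ↑ˡ n) → KAdj m n w (i′ ↑ˡ n)
    retarget i i′ (inj₁ (_ , m≤i))  = ⊥-elim (<⇒≱ (toℕ-↑ˡ<m i) m≤i)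
    retarget i i′ (inj₂ (m≤w , _)) = inj₂ (m≤w , toℕ-↑ˡ<m i′)

  ↑ʳ-twins : ∀ j j′ → Twins (K m n) (m ↑ʳ j) (m ↑ʳ j′)
  ↑ʳ-twins j j′ w = retarget j j′ , retarget j′ j
    where
    retarget : ∀ j j′ → KAdj m n w (m ↑ʳ j) → KAdj m n w (m ↑ʳ j′)
    retarget j j′ (inj₁ (w<m , _)) = inj₁ (w<m , m≤toℕ-↑ʳ j′)
    retarget j j′ (inj₂ (_ , j<m))  = ⊥-elim (<⇒≱ j<m (m≤toℕ-↑ʳ j))

  Xˢ Yˢ : Subset (m + n)
  Xˢ = ⊤ {m} ++ ⊥ {n}
  Yˢ = ⊥ {m} ++ ⊤ {n}

  ∣Xˢ∣≡m : ∣ Xˢ ∣ ≡ m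
  ∣Xˢ∣≡m = trans (∣p++q∣≡∣p∣+∣q∣ (⊤ {m}) (⊥ {n})) (trans (cong₂ _+_ (∣⊤∣≡n m) (∣⊥∣≡0 n)) (+-identityʳ m))

  ∣Yˢ∣≡n : ∣ Yˢ ∣ ≡ n
  ∣Yˢ∣≡n = trans (∣p++q∣≡∣p∣+∣q∣ (⊥ {m}) (⊤ {n})) (cong₂ _+_ (∣⊥∣≡0 m) (∣⊤∣≡n n))

  neighbours-↑ˡ∈Yˢ : ∀ i v → KAdj m n v (i ↑ˡ n) → v ∈ Yˢ
  neighbours-↑ˡ∈Yˢ i v vi with side m n v
  ... | left i′ = ⊥-elim (¬adj-↑ˡ↑ˡ i′ i vi)
  ... | right j = ∈-++⁺ʳ {p = ⊥ {m}} ∈⊤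

  neighbours-↑ʳ∈Xˢ : ∀ j v → KAdj m n v (m ↑ʳ j) → v ∈ Xˢ
  neighbours-↑ʳ∈Xˢ j v vj with side m n v
  ... | left i   = ∈-++⁺ˡ {q = ⊥ {n}} ∈⊤
  ... | right j′ = ⊥-elim (¬adj-↑ʳ↑ʳ j′ j vj)

  ∃-↑ˡ∉ : ∀ {L} → ∣ L ∣ < m → ∃ λ i → i ↑ˡ n ∉ L
  ∃-↑ˡ∉ {L} ∣L∣<m with ∣p∣<∣q∣⇒∃∈q∉p L Xˢ (subst (∣ L ∣ <_) (≡.sym ∣Xˢ∣≡m) ∣L∣<m)
  ... | u , u∈Xˢ , u∉L with side m n u
  ...   | left i  = i , u∉L
  ...   | right j = ⊥-elim (∉⊥ (∈-++⁻ʳ {p = ⊤ {m}} u∈Xˢ))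

  ∃-↑ʳ∉ : ∀ {L} → ∣ L ∣ < n → ∃ λ j → m ↑ʳ j ∉ L
  ∃-↑ʳ∉ {L} ∣L∣<n with ∣p∣<∣q∣⇒∃∈q∉p L Yˢ (subst (∣ L ∣ <_) (≡.sym ∣Yˢ∣≡n) ∣L∣<n)
  ... | u , u∈Yˢ , u∉L with side m n u
  ...   | left i  = ⊥-elim (∉⊥ (∈-++⁻ˡ {q = ⊤ {n}} u∈Yˢ))
  ...   | right j = j , u∉L

  zeroForcing⇒↑ˡ∉-unique : ∀ {B} → IsZeroForcingSet (K m n) B →
    ∀ i i′ → i ↑ˡ n ∉ B → i′ ↑ˡ n ∉ B → i ≡ i′
  zeroForcing⇒↑ˡ∉-unique zf i i′ i∉B i′∉B with i ≟ i′
  ... | yes i≡i′ = i≡i′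
  ... | no i≢i′  = ⊥-elim (twins-uncolored (↑ˡ-twins i i′) (i≢i′ ∘ ↑ˡ-injective n i i′) i∉B i′∉B (zf (i ↑ˡ n)))

  zeroForcing⇒↑ʳ∉-unique : ∀ {B} → IsZeroForcingSet (K m n) B →
    ∀ j j′ → m ↑ʳ j ∉ B → m ↑ʳ j′ ∉ B → j ≡ j′
  zeroForcing⇒↑ʳ∉-unique zf j j′ j∉B j′∉B with j ≟ j′
  ... | yes j≡j′ = j≡j′
  ... | no j≢j′  = ⊥-elim (twins-uncolored (↑ʳ-twins j j′) (j≢j′ ∘ ↑ʳ-injective m j j′) j∉B j′∉B (zf (m ↑ʳ j)))

  zeroForcing⇒m+n≤2+∣B∣ : ∀ B → IsZeroForcingSet (K m n) B → m + n ≤ 2 + ∣ B ∣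
  zeroForcing⇒m+n≤2+∣B∣ B zf with splitAt m B
  ... | p , q , refl = begin
    m + n                 ≤⟨ +-mono-≤ (∉-unique⇒n≤1+∣p∣ p ↑ˡ∉-unique) (∉-unique⇒n≤1+∣p∣ q ↑ʳ∉-unique) ⟩
    suc ∣ p ∣ + suc ∣ q ∣ ≡⟨ cong suc (+-suc ∣ p ∣ ∣ q ∣) ⟩
    2 + (∣ p ∣ + ∣ q ∣)   ≡⟨ cong (2 +_) (≡.sym (∣p++q∣≡∣p∣+∣q∣ p q)) ⟩
    2 + ∣ p ++ q ∣        ∎
    where
    open ≤-Reasoning
    ↑ˡ∉-unique : ∀ i i′ → i ∉ p → i′ ∉ p → i ≡ i′
    ↑ˡ∉-unique i i′ i∉p i′∉p = zeroForcing⇒↑ˡ∉-unique zf i i′ (i∉p ∘ ∈-++⁻ˡ) (i′∉p ∘ ∈-++⁻ˡ)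
    ↑ʳ∉-unique : ∀ j j′ → j ∉ q → j′ ∉ q → j ≡ j′
    ↑ʳ∉-unique j j′ j∉q j′∉q = zeroForcing⇒↑ʳ∉-unique zf j j′ (j∉q ∘ ∈-++⁻ʳ {p = p}) (j′∉q ∘ ∈-++⁻ʳ {p = p})

  leaky⇒↑ˡ∈ : ∀ {ℓ B} → n ≤ ℓ → IsLeakyForcingSet ℓ (K m n) B → ∀ i → i ↑ˡ n ∈ B
  leaky⇒↑ˡ∈ {B = B} n≤ℓ lk i = decidable-stable (i ↑ˡ n ∈? B) λ i∉B →
    leaky-neighbours⇒uncolored (neighbours-↑ˡ∈Yˢ i) i∉B (lk Yˢ (≤-trans (≤-reflexive ∣Yˢ∣≡n) n≤ℓ) (i ↑ˡ n))

  leaky⇒↑ʳ∈ : ∀ {ℓ B} → m ≤ ℓ → IsLeakyForcingSet ℓ (K m n) B → ∀ j → m ↑ʳ j ∈ B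
  leaky⇒↑ʳ∈ {B = B} m≤ℓ lk j = decidable-stable (m ↑ʳ j ∈? B) λ j∉B →
    leaky-neighbours⇒uncolored (neighbours-↑ʳ∈Xˢ j) j∉B (lk Xˢ (≤-trans (≤-reflexive ∣Xˢ∣≡m) m≤ℓ) (m ↑ʳ j))

  leaky⇒m+n≤1+∣B∣ : ∀ {ℓ} B → n ≤ ℓ → IsLeakyForcingSet ℓ (K m n) B → m + n ≤ 1 + ∣ B ∣
  leaky⇒m+n≤1+∣B∣ B n≤ℓ lk = ∉-unique⇒n≤1+∣p∣ B ∉-unique
    where
    ∉-unique : ∀ u v → u ∉ B → v ∉ B → u ≡ v
    ∉-unique u v u∉B v∉B with side m n u | side m n v
    ... | left i  | _        = ⊥-elim (u∉B (leaky⇒↑ˡ∈ n≤ℓ lk i))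
    ... | right _ | left i   = ⊥-elim (v∉B (leaky⇒↑ˡ∈ n≤ℓ lk i))
    ... | right j | right j′ = cong (m ↑ʳ_) (zeroForcing⇒↑ʳ∉-unique (leaky⇒zeroForcing lk) j j′ u∉B v∉B)

  leaky⇒m+n≤∣B∣ : ∀ {ℓ} B → n ≤ ℓ → m ≤ ℓ → IsLeakyForcingSet ℓ (K m n) B → m + n ≤ ∣ B ∣
  leaky⇒m+n≤∣B∣ B n≤ℓ m≤ℓ lk = ⊤⊆p⇒n≤∣p∣ λ {u} _ → ∈B u
    where
    ∈B : ∀ u → u ∈ B
    ∈B u with side m n u
    ... | left i  = leaky⇒↑ˡ∈ n≤ℓ lk i
    ... | right j = leaky⇒↑ʳ∈ m≤ℓ lk j

  ⊤-minLeaky : ∀ {ℓ} → n ≤ ℓ → m ≤ ℓ → IsMinLeakyForcingSet ℓ (K m n) ⊤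
  ⊤-minLeaky n≤ℓ m≤ℓ = ⊤-leakyForcing , λ B lk →
    subst (_≤ ∣ B ∣) (≡.sym (∣⊤∣≡n (m + n))) (leaky⇒m+n≤∣B∣ B n≤ℓ m≤ℓ lk)

module ForcingSets (m′ n′ : ℕ) where

  m n : ℕ
  m = suc m′
  n = suc n′

  open CompleteBipartite m n public

  x₀ y₀ : Fin (m + n)
  x₀ = zero ↑ˡ n
  y₀ = m ↑ʳ zero

  V∖⁅x₀,y₀⁆ V∖⁅y₀⁆ : Subset (m + n)
  V∖⁅x₀,y₀⁆ = (outside ∷ ⊤ {m′}) ++ (outside ∷ ⊤ {n′})
  V∖⁅y₀⁆    = ⊤ {m} ++ (outside ∷ ⊤ {n′})

  x₀∉V∖⁅x₀,y₀⁆ : x₀ ∉ V∖⁅x₀,y₀⁆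
  x₀∉V∖⁅x₀,y₀⁆ = (λ ()) ∘ ∈-++⁻ˡ {p = outside ∷ ⊤ {m′}} {q = outside ∷ ⊤ {n′}}

  y₀∉V∖⁅x₀,y₀⁆ : y₀ ∉ V∖⁅x₀,y₀⁆
  y₀∉V∖⁅x₀,y₀⁆ = (λ ()) ∘ ∈-++⁻ʳ {p = outside ∷ ⊤ {m′}} {q = outside ∷ ⊤ {n′}}

  ∈V∖⁅x₀,y₀⁆ : ∀ u → u ≢ x₀ → u ≢ y₀ → u ∈ V∖⁅x₀,y₀⁆
  ∈V∖⁅x₀,y₀⁆ u u≢x₀ u≢y₀ with side m n u
  ... | left zero     = ⊥-elim (u≢x₀ refl)
  ... | left (suc i)  = ∈-++⁺ˡ (there ∈⊤)
  ... | right zero    = ⊥-elim (u≢y₀ refl)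
  ... | right (suc j) = ∈-++⁺ʳ {p = outside ∷ ⊤ {m′}} (there ∈⊤)

  ∈V∖⁅y₀⁆ : ∀ u → u ≢ y₀ → u ∈ V∖⁅y₀⁆
  ∈V∖⁅y₀⁆ u u≢y₀ with side m n u
  ... | left i        = ∈-++⁺ˡ ∈⊤
  ... | right zero    = ⊥-elim (u≢y₀ refl)
  ... | right (suc j) = ∈-++⁺ʳ {p = ⊤ {m}} (there ∈⊤)

  V∖⁅x₀,y₀⁆⊆V∖⁅y₀⁆ : V∖⁅x₀,y₀⁆ ⊆ V∖⁅y₀⁆
  V∖⁅x₀,y₀⁆⊆V∖⁅y₀⁆ {u} u∈V = ∈V∖⁅y₀⁆ u λ { refl → y₀∉V∖⁅x₀,y₀⁆ u∈V }

  2+∣V∖⁅x₀,y₀⁆∣≡m+n : 2 + ∣ V∖⁅x₀,y₀⁆ ∣ ≡ m + n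
  2+∣V∖⁅x₀,y₀⁆∣≡m+n = begin
    2 + ∣ V∖⁅x₀,y₀⁆ ∣             ≡⟨ cong (2 +_) (∣p++q∣≡∣p∣+∣q∣ (outside ∷ ⊤ {m′}) (outside ∷ ⊤ {n′})) ⟩
    2 + (∣ ⊤ {m′} ∣ + ∣ ⊤ {n′} ∣) ≡⟨ cong₂ (λ a b → 2 + (a + b)) (∣⊤∣≡n m′) (∣⊤∣≡n n′) ⟩
    2 + (m′ + n′)                 ≡⟨ cong suc (≡.sym (+-suc m′ n′)) ⟩
    m + n                         ∎
    where open ≡-Reasoning

  1+∣V∖⁅y₀⁆∣≡m+n : 1 + ∣ V∖⁅y₀⁆ ∣ ≡ m + n
  1+∣V∖⁅y₀⁆∣≡m+n = begin
    1 + ∣ V∖⁅y₀⁆ ∣               ≡⟨ cong suc (∣p++q∣≡∣p∣+∣q∣ (⊤ {m}) (outside ∷ ⊤ {n′})) ⟩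
    1 + (∣ ⊤ {m} ∣ + ∣ ⊤ {n′} ∣) ≡⟨ cong₂ (λ a b → 1 + (a + b)) (∣⊤∣≡n m) (∣⊤∣≡n n′) ⟩
    1 + (m + n′)                 ≡⟨ ≡.sym (+-suc m n′) ⟩
    m + n                        ∎
    where open ≡-Reasoning

  n≤∣V∖⁅x₀,y₀⁆∣ : 2 ≤ m → n ≤ ∣ V∖⁅x₀,y₀⁆ ∣
  n≤∣V∖⁅x₀,y₀⁆∣ 2≤m = +-cancelˡ-≤ 2 n _ (subst (2 + n ≤_) (≡.sym 2+∣V∖⁅x₀,y₀⁆∣≡m+n) (+-mono-≤ 2≤m (≤-reflexive refl)))

  V∖⁅x₀,y₀⁆-forces : ∀ {L i j} → i ↑ˡ n ∉ L → m ↑ʳ j ∉ L → i ≢ zero ⊎ j ≢ zero →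
    ∀ u → Colored (K m n) V∖⁅x₀,y₀⁆ L u
  V∖⁅x₀,y₀⁆-forces {i = i} {j} x∉L y∉L (inj₁ i≢0) =
    force-two-last ∈V∖⁅x₀,y₀⁆ x∉L (i≢0 ∘ ↑ˡ-injective n i zero)
      (adj-↑ˡ↑ʳ i zero) (¬adj-↑ˡ↑ˡ i zero) y∉L (adj-↑ʳ↑ˡ j zero)
  V∖⁅x₀,y₀⁆-forces {i = i} {j} x∉L y∉L (inj₂ j≢0) =
    force-two-last (λ u u≢y₀ u≢x₀ → ∈V∖⁅x₀,y₀⁆ u u≢x₀ u≢y₀) y∉L (j≢0 ∘ ↑ʳ-injective m j zero)
      (adj-↑ʳ↑ˡ j zero) (¬adj-↑ʳ↑ʳ j zero) x∉L (adj-↑ˡ↑ʳ i zero)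

  V∖⁅y₀⁆-forces : ∀ {L i} → i ↑ˡ n ∉ L → ∀ u → Colored (K m n) V∖⁅y₀⁆ L u
  V∖⁅y₀⁆-forces {i = i} x∉L = force-last (λ u u≢y₀ → initial (∈V∖⁅y₀⁆ u u≢y₀)) x∉L (adj-↑ˡ↑ʳ i zero)

  V∖⁅x₀,y₀⁆-minZeroForcing : 2 ≤ m → IsMinZeroForcingSet (K m n) V∖⁅x₀,y₀⁆
  V∖⁅x₀,y₀⁆-minZeroForcing (s≤s 1≤m′) =
    V∖⁅x₀,y₀⁆-forces {i = suc (fromℕ< 1≤m′)} {j = zero} ∉⊥ ∉⊥ (inj₁ λ ()) , λ B zf →
      +-cancelˡ-≤ 2 _ _ (subst (_≤ 2 + ∣ B ∣) (≡.sym 2+∣V∖⁅x₀,y₀⁆∣≡m+n) (zeroForcing⇒m+n≤2+∣B∣ B zf))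

  V∖⁅x₀,y₀⁆-forces-∣L∣<n : ∀ {L} → 2 ≤ m → n ≤ m → ∣ L ∣ < n → ∀ u → Colored (K m n) V∖⁅x₀,y₀⁆ L u
  V∖⁅x₀,y₀⁆-forces-∣L∣<n {L} 2≤m n≤m ∣L∣<n
    with ∣p∣<∣q∣⇒∃∈q∉p L V∖⁅x₀,y₀⁆ (≤-trans ∣L∣<n (n≤∣V∖⁅x₀,y₀⁆∣ 2≤m))
  ... | u , u∈V , u∉L with side m n u
  ...   | left i  = V∖⁅x₀,y₀⁆-forces u∉L (proj₂ (∃-↑ʳ∉ ∣L∣<n))
                      (inj₁ λ { refl → x₀∉V∖⁅x₀,y₀⁆ u∈V })
  ...   | right j = V∖⁅x₀,y₀⁆-forces (proj₂ (∃-↑ˡ∉ (≤-trans ∣L∣<n n≤m))) u∉L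
                      (inj₂ λ { refl → y₀∉V∖⁅x₀,y₀⁆ u∈V })

  V∖⁅y₀⁆-minLeaky : ∀ {ℓ} → n ≤ ℓ → ℓ < m → IsMinLeakyForcingSet ℓ (K m n) V∖⁅y₀⁆
  V∖⁅y₀⁆-minLeaky n≤ℓ ℓ<m =
    (λ L ∣L∣≤ℓ → V∖⁅y₀⁆-forces (proj₂ (∃-↑ˡ∉ (≤-<-trans ∣L∣≤ℓ ℓ<m)))) , λ B lk →
      +-cancelˡ-≤ 1 _ _ (subst (_≤ 1 + ∣ B ∣) (≡.sym 1+∣V∖⁅y₀⁆∣≡m+n) (leaky⇒m+n≤1+∣B∣ B n≤ℓ lk))

  minLeakyForcingSet⊇V∖⁅x₀,y₀⁆ : ∀ ℓ → 1 ≤ ℓ → n ≤ m →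
    Σ (Subset (m + n)) λ Bℓ → IsMinLeakyForcingSet ℓ (K m n) Bℓ × V∖⁅x₀,y₀⁆ ⊆ Bℓ
  minLeakyForcingSet⊇V∖⁅x₀,y₀⁆ ℓ 1≤ℓ n≤m with ℓ <? n | ℓ <? m
  ... | yes ℓ<n | _      = V∖⁅x₀,y₀⁆ , minZeroForcing⇒minLeaky (V∖⁅x₀,y₀⁆-minZeroForcing 2≤m)
                             (λ L ∣L∣≤ℓ → V∖⁅x₀,y₀⁆-forces-∣L∣<n 2≤m n≤m (≤-<-trans ∣L∣≤ℓ ℓ<n)) , id
    where
    2≤m : 2 ≤ m
    2≤m = ≤-trans (s≤s 1≤ℓ) (≤-trans ℓ<n n≤m)
  ... | no ℓ≮n | yes ℓ<m = V∖⁅y₀⁆ , V∖⁅y₀⁆-minLeaky (≮⇒≥ ℓ≮n) ℓ<m , V∖⁅x₀,y₀⁆⊆V∖⁅y₀⁆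
  ... | no ℓ≮n | no ℓ≮m  = ⊤ , ⊤-minLeaky (≮⇒≥ ℓ≮n) (≮⇒≥ ℓ≮m) , ⊆⊤

corollary4p2 : (m n ℓ : ℕ) → n ≤ m → 1 ≤ n → 1 ≤ ℓ →
    Σ (Subset (m + n)) λ B → Σ (Subset (m + n)) λ Bℓ →
    IsMinZeroForcingSet (K m n) B × IsMinLeakyForcingSet ℓ (K m n) Bℓ × B ⊆ Bℓ
corollary4p2 _ zero _ _ () _
corollary4p2 zero (suc _) _ () _ _
corollary4p2 (suc zero) (suc (suc _)) _ (s≤s ()) _ _
-- K_{1,1} is the one case where V ∖ {x₀, y₀} = ∅ is not zero forcing.
corollary4p2 (suc zero) (suc zero) ℓ _ _ 1≤ℓ =
  V∖⁅y₀⁆ , ⊤ , (V∖⁅y₀⁆-forces {i = zero} ∉⊥ , λ _ → zeroForcing⇒0<∣B∣) , ⊤-minLeaky 1≤ℓ 1≤ℓ , ⊆⊤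
  where open ForcingSets 0 0
corollary4p2 (suc (suc m″)) (suc n′) ℓ n≤m _ 1≤ℓ =
  let Bℓ , minLeaky , V∖⁅x₀,y₀⁆⊆Bℓ = minLeakyForcingSet⊇V∖⁅x₀,y₀⁆ ℓ 1≤ℓ n≤m in
  V∖⁅x₀,y₀⁆ , Bℓ , V∖⁅x₀,y₀⁆-minZeroForcing (s≤s (s≤s z≤n)) , minLeaky , V∖⁅x₀,y₀⁆⊆Bℓ
  where open ForcingSets (suc m″) n′
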